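{- Let $n\in\mathbb{N}$, $t\in\mathbb{N}$ and $k\in[n]$. There exists a family of hyperplanes $H_1,\dots,H_m$ in $\mathbb{R}^n$, where $m=\max\{k,n-k\}+2t-2$, such that every point of $\mathcal{Q}^n_k$ is covered exactly $t-1$ times and every point of $\mathcal{Q}^n\setminus\mathcal{Q}^n_k$ is covered at least $t$ times.
   Context: $\mathcal{Q}^n=\{0,1\}^n\subset\mathbb{R}^n$, and $\mathcal{Q}^n_k$ is the set of points of $\mathcal{Q}^n$ with exactly $k$ coordinates equal to $1$. A hyperplane is a set $\{x\in\mathbb{R}^n:\langle a,x\rangle=b\}$ with $a\neq 0$; a family of hyperplanes may contain repetitions. A point $u$ is covered $j$ times by $H_1,\dots,H_m$ if exactly $j$ indices $i$ satisfy $u\in H_i$. -}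

module Defs where

open import Data.Nat using (ℕ; zero; suc)
open import Data.Integer using (ℤ; _+_; 0ℤ; 1ℤ)
import Data.Integer as ℤ
open import Data.Bool using (Bool; true; false)
open import Data.Fin using (Fin; zero; suc)
open import Data.Product using (∃)
open import Relation.Binary.PropositionalEquality using (_≡_; _≢_)
open import Relation.Nullary using (yes; no)

-- A point of the cube Q^n = {0,1}^n, coordinates encoded as Bool (true = 1).
Cube : ℕ → Set
Cube n = Fin n → Bool

bit : Bool → ℤ
bit true  = 1ℤ
bit false = 0ℤ

-- number of coordinates equal to 1 (u ∈ Q^n_k  iff  weight u ≡ k)
weight : ∀ {n} → Cube n → ℕ
weight {zero}  u = 0
weight {suc n} u with u zero
... | true  = suc (weight (λ i → u (suc i)))
... | false = weight (λ i → u (suc i))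

dot : ∀ {n} → (Fin n → ℤ) → Cube n → ℤ
dot {zero}  a u = 0ℤ
dot {suc n} a u = a zero ℤ.* bit (u zero) + dot (λ i → a (suc i)) (λ i → u (suc i))

record Hyperplane (n : ℕ) : Set where
  field
    coeff    : Fin n → ℤ
    const    : ℤ
    nonzero  : ∃ λ i → coeff i ≢ 0ℤ
open Hyperplane public

coverCount : ∀ {m n} → (Fin m → Hyperplane n) → Cube n → ℕ
coverCount {zero}  H u = 0
coverCount {suc m} H u with dot (coeff (H zero)) u ℤ.≟ const (H zero)
... | yes _ = suc (coverCount (λ i → H (suc i)) u)
... | no  _ = coverCount (λ i → H (suc i)) u

-- For p < n let H_p be the hyperplane x₀ + ⋯ + x_{p-1} − (n − p)·x_p = k − (n − p).
-- A point of weight k lies on no H_p: if x_p = 1 its prefix x₀ + ⋯ + x_{p-1} is below k, and if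
-- x_p = 0 the remaining n − p − 1 coordinates cannot make up the missing n − p. A point of
-- weight > k lies on H_p where x_p is its (k+1)-st one, and a point of weight < k lies on H_p where
-- x_p is its (n−k+1)-st zero; either way p ≥ min(k, n − k). So the max(k, n − k) hyperplanes H_p
-- with min(k, n − k) ≤ p < n miss Q^n_k and cover the rest of the cube, and t − 1 copies of the
-- pair x₀ = 0, x₀ = 1 raise every count by exactly t − 1.
{-# OPTIONS --safe #-}
module Submission where

open import Defs
open import Data.Bool using (Bool; true; false)
open import Data.Empty using (⊥-elim)
open import Data.Fin using (Fin; zero; suc; toℕ; fromℕ<)
open import Data.Fin.Properties using (toℕ<n; toℕ-fromℕ<)
open import Data.Integer using (ℤ; +_; -[1+_]; -_; _-_; 0ℤ; 1ℤ)
import Data.Integer as ℤ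
import Data.Integer.Properties as ℤ
open import Data.Nat using (ℕ; zero; suc; _+_; _*_; _∸_; _⊔_; _≤_; _<_; z≤n; s≤s; s≤s⁻¹; z<s; _≟_)
open import Data.Nat.Properties
open import Data.Product using (Σ; _×_; _,_; ∃-syntax)
open import Data.Sum using (_⊎_; inj₁; inj₂)
import Data.Sum as Sum
open import Data.Vec using (Vec; []; _∷_; _++_; lookup; tabulate)
open import Data.Vec.Functional using (tail)
open import Function using (_∘_; _⇔_; mk⇔; Equivalence)
open import Relation.Nullary using (¬_; yes; no)
open import Relation.Binary.PropositionalEquality
  using (_≡_; _≢_; refl; sym; trans; cong; cong₂; subst; module ≡-Reasoning)
open import Algebra.Properties.AbelianGroup ℤ.+-0-abelianGroup using (∙-cancelʳ)

_∈ᴴ_ : ∀ {n} → Cube n → Hyperplane n → Set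
u ∈ᴴ h = dot (coeff h) u ≡ const h

∉⇒coverCount≡0 : ∀ {m n} (H : Fin m → Hyperplane n) u → (∀ i → ¬ u ∈ᴴ H i) → coverCount H u ≡ 0
∉⇒coverCount≡0 {zero}  H u u∉H = refl
∉⇒coverCount≡0 {suc m} H u u∉H with dot (coeff (H zero)) u ℤ.≟ const (H zero)
... | yes u∈H₀ = ⊥-elim (u∉H zero u∈H₀)
... | no  _    = ∉⇒coverCount≡0 (H ∘ suc) u (u∉H ∘ suc)

∈⇒0<coverCount : ∀ {m n} (H : Fin m → Hyperplane n) u i → u ∈ᴴ H i → 0 < coverCount H u
∈⇒0<coverCount {suc m} H u i u∈Hᵢ with dot (coeff (H zero)) u ℤ.≟ const (H zero)
∈⇒0<coverCount H u i       u∈Hᵢ | yes _   = z<s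
∈⇒0<coverCount H u zero    u∈H₀ | no u∉H₀ = ⊥-elim (u∉H₀ u∈H₀)
∈⇒0<coverCount H u (suc i) u∈Hᵢ | no _    = ∈⇒0<coverCount (H ∘ suc) u i u∈Hᵢ

coverCount-tabulate : ∀ {m n} (H : Fin m → Hyperplane n) u →
  coverCount (lookup (tabulate H)) u ≡ coverCount H u
coverCount-tabulate {zero}  H u = refl
coverCount-tabulate {suc m} H u with dot (coeff (H zero)) u ℤ.≟ const (H zero)
... | yes _ = cong suc (coverCount-tabulate (H ∘ suc) u)
... | no  _ = coverCount-tabulate (H ∘ suc) u

coverCount-++ : ∀ {a b n} (xs : Vec (Hyperplane n) a) (ys : Vec (Hyperplane n) b) u →
  coverCount (lookup (xs ++ ys)) u ≡ coverCount (lookup xs) u + coverCount (lookup ys) u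
coverCount-++ []       ys u = refl
coverCount-++ (x ∷ xs) ys u with dot (coeff x) u ℤ.≟ const x
... | yes _ = cong suc (coverCount-++ xs ys u)
... | no  _ = coverCount-++ xs ys u

coverCount-∷-∈ : ∀ {m n} (h : Hyperplane n) (hs : Vec (Hyperplane n) m) u →
  u ∈ᴴ h → coverCount (lookup (h ∷ hs)) u ≡ suc (coverCount (lookup hs) u)
coverCount-∷-∈ h hs u u∈h with dot (coeff h) u ℤ.≟ const h
... | yes _   = refl
... | no u∉h = ⊥-elim (u∉h u∈h)

coverCount-∷-∉ : ∀ {m n} (h : Hyperplane n) (hs : Vec (Hyperplane n) m) u →
  ¬ u ∈ᴴ h → coverCount (lookup (h ∷ hs)) u ≡ coverCount (lookup hs) u
coverCount-∷-∉ h hs u u∉h with dot (coeff h) u ℤ.≟ const h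
... | yes u∈h = ⊥-elim (u∉h u∈h)
... | no _    = refl

dot-zeroˡ : ∀ {n} (u : Cube n) → dot (λ _ → 0ℤ) u ≡ 0ℤ
dot-zeroˡ {zero}  u = refl
dot-zeroˡ {suc n} u = trans (ℤ.+-identityˡ _) (dot-zeroˡ (tail u))

firstCoordinate : ∀ {n} → Fin (suc n) → ℤ
firstCoordinate zero    = 1ℤ
firstCoordinate (suc _) = 0ℤ

dot-firstCoordinate : ∀ {n} (u : Cube (suc n)) → dot firstCoordinate u ≡ bit (u zero)
dot-firstCoordinate u = begin
  1ℤ ℤ.* bit (u zero) ℤ.+ dot (λ _ → 0ℤ) (tail u)
    ≡⟨ cong₂ ℤ._+_ (ℤ.*-identityˡ (bit (u zero))) (dot-zeroˡ (tail u)) ⟩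
  bit (u zero) ℤ.+ 0ℤ
    ≡⟨ ℤ.+-identityʳ _ ⟩
  bit (u zero)
    ∎
  where open ≡-Reasoning

x₀≡_ : ∀ {n} → ℤ → Hyperplane (suc n)
x₀≡ c = record { coeff = firstCoordinate ; const = c ; nonzero = zero , λ () }

coverCount-x₀≡0∷x₀≡1∷ : ∀ {m n} (hs : Vec (Hyperplane (suc n)) m) u →
  coverCount (lookup (x₀≡ 0ℤ ∷ x₀≡ 1ℤ ∷ hs)) u ≡ suc (coverCount (lookup hs) u)
coverCount-x₀≡0∷x₀≡1∷ hs u = onBit (u zero) (dot-firstCoordinate u)
  where
  onBit : ∀ b → dot firstCoordinate u ≡ bit b →
    coverCount (lookup (x₀≡ 0ℤ ∷ x₀≡ 1ℤ ∷ hs)) u ≡ suc (coverCount (lookup hs) u)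
  onBit true  x₀≡1 =
    trans (coverCount-∷-∉ (x₀≡ 0ℤ) _ u (λ x₀≡0 → ⊥-elim (1≢0 (trans (sym x₀≡1) x₀≡0))))
          (coverCount-∷-∈ (x₀≡ 1ℤ) hs u x₀≡1)
    where
    1≢0 : 1ℤ ≢ 0ℤ
    1≢0 ()
  onBit false x₀≡0 =
    trans (coverCount-∷-∈ (x₀≡ 0ℤ) _ u x₀≡0)
          (cong suc (coverCount-∷-∉ (x₀≡ 1ℤ) hs u (λ x₀≡1 → ⊥-elim (0≢1 (trans (sym x₀≡0) x₀≡1)))))
    where
    0≢1 : 0ℤ ≢ 1ℤ
    0≢1 ()

coordinatePairs : ∀ {n} t → Vec (Hyperplane (suc n)) (t * 2)
coordinatePairs zero    = []
coordinatePairs (suc t) = x₀≡ 0ℤ ∷ x₀≡ 1ℤ ∷ coordinatePairs t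

coverCount-coordinatePairs : ∀ {n} t (u : Cube (suc n)) →
  coverCount (lookup (coordinatePairs t)) u ≡ t
coverCount-coordinatePairs zero    u = refl
coverCount-coordinatePairs (suc t) u =
  trans (coverCount-x₀≡0∷x₀≡1∷ (coordinatePairs t) u) (cong suc (coverCount-coordinatePairs t u))

prefixCoeff : (n p : ℕ) → Fin n → ℤ
prefixCoeff (suc n) zero    zero    = -[1+ n ]
prefixCoeff (suc n) zero    (suc _) = 0ℤ
prefixCoeff (suc n) (suc p) zero    = 1ℤ
prefixCoeff (suc n) (suc p) (suc i) = prefixCoeff n p i

-- u₀ + ⋯ + u_{p-1} + (n − p)·(1 − u_p), the left-hand side of H_p shifted by n − p.
-- Dispatching on u zero in a helper, before p, makes prefixValue p u unfold under
-- `with u zero` even for a variable p.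
prefixValue : ∀ {n} → ℕ → Cube n → ℕ
prefixValue {zero}  _ _ = 0
prefixValue {suc n} p u = onHead p (u zero)
  where
  onHead : ℕ → Bool → ℕ
  onHead zero    true  = 0
  onHead zero    false = suc n
  onHead (suc p) true  = suc (prefixValue p (tail u))
  onHead (suc p) false = prefixValue p (tail u)

dot-prefixCoeff : ∀ {n} p (u : Cube n) → dot (prefixCoeff n p) u ≡ + prefixValue p u - + (n ∸ p)
dot-prefixCoeff {zero}  zero    u = refl
dot-prefixCoeff {zero}  (suc p) u = refl
dot-prefixCoeff {suc n} zero    u with u zero
... | true  = trans (cong₂ ℤ._+_ (ℤ.*-identityʳ -[1+ n ]) (dot-zeroˡ (tail u))) (ℤ.+-identityʳ _)
... | false = trans (cong₂ ℤ._+_ (ℤ.*-zeroʳ -[1+ n ]) (dot-zeroˡ (tail u))) (sym (ℤ.+-inverseʳ (+ suc n)))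
dot-prefixCoeff {suc n} (suc p) u with u zero
... | true  = trans (cong (λ z → 1ℤ ℤ.+ z) (dot-prefixCoeff p (tail u)))
                    (sym (ℤ.+-assoc 1ℤ (+ prefixValue p (tail u)) (- + (n ∸ p))))
... | false = trans (ℤ.+-identityˡ _) (dot-prefixCoeff p (tail u))

prefixHyperplane : (n k p : ℕ) → Hyperplane (suc n)
prefixHyperplane n k p = record
  { coeff   = prefixCoeff (suc n) p
  ; const   = + k - + (suc n ∸ p)
  ; nonzero = zero , head≢0 p
  }
  where
  head≢0 : ∀ p → prefixCoeff (suc n) p zero ≢ 0ℤ
  head≢0 zero    ()
  head≢0 (suc p) ()

∈-prefixHyperplane : ∀ {n} k p (u : Cube (suc n)) → u ∈ᴴ prefixHyperplane n k p ⇔ prefixValue p u ≡ k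
∈-prefixHyperplane {n} k p u = mk⇔
  (λ u∈H → ℤ.+-injective (∙-cancelʳ (- + (suc n ∸ p)) _ _ (trans (sym (dot-prefixCoeff p u)) u∈H)))
  (λ v≡k → trans (dot-prefixCoeff p u) (cong (λ v → + v - + (suc n ∸ p)) v≡k))

weight≤ : ∀ {n} (u : Cube n) → weight u ≤ n
weight≤ {zero}  u = z≤n
weight≤ {suc n} u with u zero
... | true  = s≤s (weight≤ (tail u))
... | false = m≤n⇒m≤1+n (weight≤ (tail u))

prefixValue≢weight : ∀ {n} p (u : Cube n) → p < n → prefixValue p u ≢ weight u
prefixValue≢weight {suc n} zero u _ with u zero
... | true  = λ ()
... | false = λ 1+n≡w → 1+n≰n (subst (_≤ n) (sym 1+n≡w) (weight≤ (tail u)))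
prefixValue≢weight {suc n} (suc p) u (s≤s p<n) with u zero
... | true  = prefixValue≢weight p (tail u) p<n ∘ suc-injective
... | false = prefixValue≢weight p (tail u) p<n

∃prefixValue≡ : ∀ {n} k (u : Cube n) → k ≤ n → weight u ≢ k →
  ∃[ p ] p < n × (n ∸ k ≤ p ⊎ k ≤ p) × prefixValue p u ≡ k
∃prefixValue≡ {zero}  zero u _ w≢k = ⊥-elim (w≢k refl)
∃prefixValue≡ {suc n} k u k≤1+n w≢k with u zero
∃prefixValue≡ {suc n} zero    u _         _   | true = 0 , z<s , inj₂ z≤n , refl
∃prefixValue≡ {suc n} (suc k) u (s≤s k≤n) w≢k | true =
  let p , p<n , p≥ , v≡k = ∃prefixValue≡ k (tail u) k≤n (w≢k ∘ cong suc)
  in  suc p , s≤s p<n , Sum.map m≤n⇒m≤1+n s≤s p≥ , cong suc v≡k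
∃prefixValue≡ {suc n} k       u k≤1+n     w≢k | false with k ≟ suc n
... | yes refl = 0 , z<s , inj₁ (≤-reflexive (n∸n≡0 n)) , refl
... | no k≢1+n =
  let k≤n = s≤s⁻¹ (≤∧≢⇒< k≤1+n k≢1+n)
      p , p<n , p≥ , v≡k = ∃prefixValue≡ k (tail u) k≤n w≢k
  in  suc p , s≤s p<n , Sum.map (≤-trans (≤-reflexive (+-∸-assoc 1 k≤n)) ∘ s≤s) m≤n⇒m≤1+n p≥ , v≡k

n∸[k⊔[n∸k]]≤p : ∀ {n k p} → k ≤ n → n ∸ k ≤ p ⊎ k ≤ p → n ∸ (k ⊔ (n ∸ k)) ≤ p
n∸[k⊔[n∸k]]≤p {n} {k} k≤n (inj₁ n∸k≤p) = ≤-trans (∸-monoʳ-≤ n (m≤m⊔n k (n ∸ k))) n∸k≤p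
n∸[k⊔[n∸k]]≤p {n} {k} k≤n (inj₂ k≤p)   = begin
  n ∸ (k ⊔ (n ∸ k)) ≤⟨ ∸-monoʳ-≤ n (m≤n⊔m k (n ∸ k)) ⟩
  n ∸ (n ∸ k)       ≡⟨ m∸[m∸n]≡n k≤n ⟩
  k                 ≤⟨ k≤p ⟩
  _                 ∎
  where open ≤-Reasoning

prefixCover : (n k : ℕ) → Fin (k ⊔ (suc n ∸ k)) → Hyperplane (suc n)
prefixCover n k i = prefixHyperplane n k (suc n ∸ (k ⊔ (suc n ∸ k)) + toℕ i)

module _ {n k : ℕ} (k≤1+n : k ≤ suc n) where

  private
    size : ℕ
    size = k ⊔ (suc n ∸ k)

    offset : ℕ
    offset = suc n ∸ size

    size≤1+n : size ≤ suc n
    size≤1+n = ⊔-lub k≤1+n (m∸n≤m (suc n) k)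

  coverCount-prefixCover-onLayer : ∀ u → weight u ≡ k → coverCount (prefixCover n k) u ≡ 0
  coverCount-prefixCover-onLayer u w≡k = ∉⇒coverCount≡0 (prefixCover n k) u λ i u∈H →
    prefixValue≢weight (offset + toℕ i) u (index<1+n i)
      (trans (Equivalence.to (∈-prefixHyperplane k (offset + toℕ i) u) u∈H) (sym w≡k))
    where
    index<1+n : ∀ i → offset + toℕ i < suc n
    index<1+n i = begin-strict
      offset + toℕ i <⟨ +-monoʳ-< offset (toℕ<n i) ⟩
      offset + size  ≡⟨ m∸n+n≡m size≤1+n ⟩
      suc n          ∎
      where open ≤-Reasoning

  coverCount-prefixCover-offLayer : ∀ u → weight u ≢ k → 0 < coverCount (prefixCover n k) u
  coverCount-prefixCover-offLayer u w≢k with ∃prefixValue≡ k u k≤1+n w≢k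
  ... | p , p<1+n , p≥ , v≡k = ∈⇒0<coverCount (prefixCover n k) u i
    (Equivalence.from (∈-prefixHyperplane k (offset + toℕ i) u)
      (subst (λ p → prefixValue p u ≡ k) (sym offset+i≡p) v≡k))
    where
    offset≤p : offset ≤ p
    offset≤p = n∸[k⊔[n∸k]]≤p k≤1+n p≥
    p∸offset<size : p ∸ offset < size
    p∸offset<size = subst (p ∸ offset <_) (m∸[m∸n]≡n size≤1+n) (∸-monoˡ-< p<1+n offset≤p)
    i : Fin size
    i = fromℕ< p∸offset<size
    offset+i≡p : offset + toℕ i ≡ p
    offset+i≡p = trans (cong (λ j → offset + j) (toℕ-fromℕ< p∸offset<size)) (m+[n∸m]≡n offset≤p)

familySize≡ : ∀ m t → m + 2 * suc t ∸ 2 ≡ m + t * 2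
familySize≡ m t = trans (cong (λ j → m + j ∸ 2) (*-comm 2 (suc t))) (+-∸-assoc m (s≤s (s≤s z≤n)))

theorem1p5 : (n t k : ℕ) → 1 ≤ t → 1 ≤ k → k ≤ n →
    Σ (Fin ((k ⊔ (n ∸ k)) + 2 * t ∸ 2) → Hyperplane n) λ H →
      ((u : Cube n) → weight u ≡ k → coverCount H u ≡ t ∸ 1) ×
      ((u : Cube n) → weight u ≢ k → t ≤ coverCount H u)
theorem1p5 _       zero    _ ()     _       _
theorem1p5 zero    (suc t) _ _      (s≤s _) ()
theorem1p5 (suc n) (suc t) k _      _       k≤1+n rewrite familySize≡ (k ⊔ (suc n ∸ k)) t =
  lookup family , onLayer , offLayer
  where
  family : Vec (Hyperplane (suc n)) (k ⊔ (suc n ∸ k) + t * 2)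
  family = tabulate (prefixCover n k) ++ coordinatePairs t

  count : ∀ u → coverCount (lookup family) u ≡ coverCount (prefixCover n k) u + t
  count u = begin
    coverCount (lookup family) u
      ≡⟨ coverCount-++ (tabulate (prefixCover n k)) (coordinatePairs t) u ⟩
    coverCount (lookup (tabulate (prefixCover n k))) u + coverCount (lookup (coordinatePairs t)) u
      ≡⟨ cong₂ _+_ (coverCount-tabulate (prefixCover n k) u) (coverCount-coordinatePairs t u) ⟩
    coverCount (prefixCover n k) u + t
      ∎
    where open ≡-Reasoning

  onLayer : ∀ u → weight u ≡ k → coverCount (lookup family) u ≡ t
  onLayer u w≡k = trans (count u) (cong (_+ t) (coverCount-prefixCover-onLayer k≤1+n u w≡k))

  offLayer : ∀ u → weight u ≢ k → suc t ≤ coverCount (lookup family) u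
  offLayer u w≢k =
    subst (suc t ≤_) (sym (count u)) (+-monoˡ-≤ t (coverCount-prefixCover-offLayer k≤1+n u w≢k))
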